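{- For any modal formula $A$, $\mathbf{NR}\vdash A$ if and only if $\mathbf{NR}\vdash\chi(A)$.
   Context: Modal formulas are built from propositional variables and $\bot$ using $\neg,\land,\lor,\to$ and $\Box$; $\Diamond A$ abbreviates $\neg\Box\neg A$. $\mathbf{N}$ has all propositional tautologies as axioms and Modus Ponens and Necessitation $A/\Box A$ as rules; $\mathbf{NR}$ is $\mathbf{N}$ plus the rule $\neg B/\neg\Box B$. The translation $\chi$ is defined by: $\chi(A)=A$ for propositional variables and $\bot$; $\chi(\neg A)=\neg\chi(A)$; $\chi(A\circ B)=\chi(A)\circ\chi(B)$ for $\circ\in\{\land,\lor,\to\}$; $\chi(\Box A)=\Diamond\chi(A)$, i.e. $\neg\Box\neg\chi(A)$. -}

module Defs where

open import Data.Nat using (ℕ)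
open import Data.Bool using (Bool; true; false; not; _∧_; _∨_)
open import Relation.Binary.PropositionalEquality using (_≡_)

infixr 5 _⇒_
infixr 6 _∨'_
infixr 7 _∧'_
data Fm : Set where
  var  : ℕ → Fm
  ⊥'   : Fm
  ¬'_  : Fm → Fm
  _∧'_ : Fm → Fm → Fm
  _∨'_ : Fm → Fm → Fm
  _⇒_  : Fm → Fm → Fm
  □_   : Fm → Fm

◇_ : Fm → Fm
◇ A = ¬' (□ (¬' A))

_⇒ᵇ_ : Bool → Bool → Bool
a ⇒ᵇ b = not a ∨ b

eval : (ℕ → Bool) → (Fm → Bool) → Fm → Bool
eval v w (var n)  = v n
eval v w ⊥'       = false
eval v w (¬' A)   = not (eval v w A)
eval v w (A ∧' B) = eval v w A ∧ eval v w B
eval v w (A ∨' B) = eval v w A ∨ eval v w B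
eval v w (A ⇒ B)  = eval v w A ⇒ᵇ eval v w B
eval v w (□ A)    = w (□ A)

-- A is a propositional tautology (substitution instance of one):
-- true under every valuation of variables and of its □-subformulas as atoms.
Tautology : Fm → Set
Tautology A = (v : ℕ → Bool) (w : Fm → Bool) → eval v w A ≡ true

data NR⊢_ : Fm → Set where
  taut : ∀ {A} → Tautology A → NR⊢ A
  mp   : ∀ {A B} → NR⊢ (A ⇒ B) → NR⊢ A → NR⊢ B
  nec  : ∀ {A} → NR⊢ A → NR⊢ (□ A)
  rr   : ∀ {B} → NR⊢ (¬' B) → NR⊢ (¬' (□ B))

χ : Fm → Fm
χ (var n)  = var n
χ ⊥'       = ⊥'
χ (¬' A)   = ¬' (χ A)
χ (A ∧' B) = χ A ∧' χ B
χ (A ∨' B) = χ A ∨' χ B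
χ (A ⇒ B)  = χ A ⇒ χ B
χ (□ A)    = ◇ (χ A)

-- χ is sound for NR because it exchanges the two box rules: necessitation of A
-- becomes rr applied to ¬¬χ(A), and rr becomes necessitation followed by ¬¬-introduction.
-- For the converse, χ⁻¹ reads □¬C back as ¬□C and ¬□¬C as □C and is homomorphic
-- otherwise; it is a left inverse of χ and is sound for NR by the same exchange of rules.
-- Both translations commute with evaluation once boxed subformulas are reinterpreted,
-- so they map tautologies to tautologies.
module Submission where

open import Defs
open import Function.Bundles using (_⇔_; mk⇔)
open import Data.Bool using (not; _∧_; _∨_)
open import Data.Bool.Properties using (not-involutive; ∨-inverseˡ)
open import Relation.Binary.PropositionalEquality
  using (_≡_; refl; sym; trans; cong; cong₂; subst)

private
  variable
    A B C : Fm

infix 4 _≈_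
_≈_ : Fm → Fm → Set
A ≈ B = ∀ v w → eval v w A ≡ eval v w B

≈⇒tautology-⇒ : A ≈ B → Tautology (A ⇒ B)
≈⇒tautology-⇒ {A} {B} A≈B v w rewrite A≈B v w = ∨-inverseˡ (eval v w B)

NR⊢-resp-≈ : A ≈ B → NR⊢ A → NR⊢ B
NR⊢-resp-≈ {A} {B} A≈B ⊢A = mp (taut (≈⇒tautology-⇒ {A} {B} A≈B)) ⊢A

¬¬-intro : NR⊢ A → NR⊢ (¬' (¬' A))
¬¬-intro {A} = NR⊢-resp-≈ {A} (λ v w → sym (not-involutive _))

¬¬-elim : NR⊢ (¬' (¬' A)) → NR⊢ A
¬¬-elim {A} = NR⊢-resp-≈ {B = A} (λ v w → not-involutive _)

Compositional : (Fm → Fm) → Set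
Compositional τ = ∀ v w B → eval v w (τ B) ≡ eval v (λ X → eval v w (τ X)) B

compositional-tautology : ∀ {τ} → Compositional τ → Tautology A → Tautology (τ A)
compositional-tautology {A} τ-comp ⊨A v w = trans (τ-comp v w A) (⊨A v _)

χ-compositional : Compositional χ
χ-compositional v w (var n)  = refl
χ-compositional v w ⊥'       = refl
χ-compositional v w (¬' A)   = cong not (χ-compositional v w A)
χ-compositional v w (A ∧' B) = cong₂ _∧_ (χ-compositional v w A) (χ-compositional v w B)
χ-compositional v w (A ∨' B) = cong₂ _∨_ (χ-compositional v w A) (χ-compositional v w B)
χ-compositional v w (A ⇒ B)  = cong₂ _⇒ᵇ_ (χ-compositional v w A) (χ-compositional v w B)
χ-compositional v w (□ A)    = refl

NR⊢-χ : NR⊢ A → NR⊢ χ A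
NR⊢-χ (taut {A} ⊨A) = taut (compositional-tautology {A} {χ} χ-compositional ⊨A)
NR⊢-χ (mp ⊢A⇒B ⊢A) = mp (NR⊢-χ ⊢A⇒B) (NR⊢-χ ⊢A)
NR⊢-χ (nec ⊢A) = rr (¬¬-intro (NR⊢-χ ⊢A))
NR⊢-χ (rr ⊢¬B) = ¬¬-intro (nec (NR⊢-χ ⊢¬B))

χ⁻¹ : Fm → Fm
χ⁻¹ (var n)         = var n
χ⁻¹ ⊥'              = ⊥'
χ⁻¹ (¬' (□ (¬' C))) = □ χ⁻¹ C
χ⁻¹ (¬' A)          = ¬' χ⁻¹ A
χ⁻¹ (A ∧' B)        = χ⁻¹ A ∧' χ⁻¹ B
χ⁻¹ (A ∨' B)        = χ⁻¹ A ∨' χ⁻¹ B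
χ⁻¹ (A ⇒ B)         = χ⁻¹ A ⇒ χ⁻¹ B
χ⁻¹ (□ (¬' C))      = ¬' (□ χ⁻¹ C)
χ⁻¹ (□ A)           = □ χ⁻¹ A

χ⁻¹-¬ : ∀ A → χ⁻¹ (¬' A) ≈ ¬' χ⁻¹ A
χ⁻¹-¬ (□ (¬' C))   v w = sym (not-involutive _)
χ⁻¹-¬ (□ (var n))  v w = refl
χ⁻¹-¬ (□ ⊥')       v w = refl
χ⁻¹-¬ (□ (A ∧' B)) v w = refl
χ⁻¹-¬ (□ (A ∨' B)) v w = refl
χ⁻¹-¬ (□ (A ⇒ B))  v w = refl
χ⁻¹-¬ (□ (□ A))    v w = refl
χ⁻¹-¬ (var n)      v w = refl
χ⁻¹-¬ ⊥'           v w = refl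
χ⁻¹-¬ (¬' A)       v w = refl
χ⁻¹-¬ (A ∧' B)     v w = refl
χ⁻¹-¬ (A ∨' B)     v w = refl
χ⁻¹-¬ (A ⇒ B)      v w = refl

χ⁻¹-compositional : Compositional χ⁻¹
χ⁻¹-compositional v w (var n)  = refl
χ⁻¹-compositional v w ⊥'       = refl
χ⁻¹-compositional v w (¬' A)   = trans (χ⁻¹-¬ A v w) (cong not (χ⁻¹-compositional v w A))
χ⁻¹-compositional v w (A ∧' B) = cong₂ _∧_ (χ⁻¹-compositional v w A) (χ⁻¹-compositional v w B)
χ⁻¹-compositional v w (A ∨' B) = cong₂ _∨_ (χ⁻¹-compositional v w A) (χ⁻¹-compositional v w B)
χ⁻¹-compositional v w (A ⇒ B)  = cong₂ _⇒ᵇ_ (χ⁻¹-compositional v w A) (χ⁻¹-compositional v w B)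
χ⁻¹-compositional v w (□ A)    = refl

NR⊢-χ⁻¹ : NR⊢ A → NR⊢ χ⁻¹ A
NR⊢-χ⁻¹ (taut {A} ⊨A) = taut (compositional-tautology {A} {χ⁻¹} χ⁻¹-compositional ⊨A)
NR⊢-χ⁻¹ (mp ⊢A⇒B ⊢A) = mp (NR⊢-χ⁻¹ ⊢A⇒B) (NR⊢-χ⁻¹ ⊢A)
NR⊢-χ⁻¹ (nec {¬' C} ⊢¬C) = rr (NR⊢-resp-≈ (χ⁻¹-¬ C) (NR⊢-χ⁻¹ ⊢¬C))
NR⊢-χ⁻¹ (nec {var n}  ⊢A) = nec (NR⊢-χ⁻¹ ⊢A)
NR⊢-χ⁻¹ (nec {⊥'}     ⊢A) = nec (NR⊢-χ⁻¹ ⊢A)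
NR⊢-χ⁻¹ (nec {A ∧' B} ⊢A) = nec (NR⊢-χ⁻¹ ⊢A)
NR⊢-χ⁻¹ (nec {A ∨' B} ⊢A) = nec (NR⊢-χ⁻¹ ⊢A)
NR⊢-χ⁻¹ (nec {A ⇒ B}  ⊢A) = nec (NR⊢-χ⁻¹ ⊢A)
NR⊢-χ⁻¹ (nec {□ A}    ⊢A) = nec (NR⊢-χ⁻¹ ⊢A)
NR⊢-χ⁻¹ (rr {¬' C} ⊢¬¬C) =
  nec (¬¬-elim (NR⊢-resp-≈ (λ v w → cong not (χ⁻¹-¬ C v w)) (NR⊢-χ⁻¹ ⊢¬¬C)))
NR⊢-χ⁻¹ (rr {var n}  ⊢¬B) = rr (NR⊢-χ⁻¹ ⊢¬B)
NR⊢-χ⁻¹ (rr {⊥'}     ⊢¬B) = rr (NR⊢-χ⁻¹ ⊢¬B)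
NR⊢-χ⁻¹ (rr {A ∧' B} ⊢¬B) = rr (NR⊢-χ⁻¹ ⊢¬B)
NR⊢-χ⁻¹ (rr {A ∨' B} ⊢¬B) = rr (NR⊢-χ⁻¹ ⊢¬B)
NR⊢-χ⁻¹ (rr {A ⇒ B}  ⊢¬B) = rr (NR⊢-χ⁻¹ ⊢¬B)
NR⊢-χ⁻¹ (rr {□ A}    ⊢¬B) = rr (NR⊢-resp-≈ (χ⁻¹-¬ (□ A)) (NR⊢-χ⁻¹ ⊢¬B))

χ⁻¹-¬-χ : ∀ A → χ⁻¹ (¬' χ A) ≡ ¬' χ⁻¹ (χ A)
χ⁻¹-¬-χ (var n)  = refl
χ⁻¹-¬-χ ⊥'       = refl
χ⁻¹-¬-χ (¬' A)   = refl
χ⁻¹-¬-χ (A ∧' B) = refl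
χ⁻¹-¬-χ (A ∨' B) = refl
χ⁻¹-¬-χ (A ⇒ B)  = refl
χ⁻¹-¬-χ (□ A)    = refl

χ⁻¹-χ : ∀ A → χ⁻¹ (χ A) ≡ A
χ⁻¹-χ (var n)  = refl
χ⁻¹-χ ⊥'       = refl
χ⁻¹-χ (¬' A)   = trans (χ⁻¹-¬-χ A) (cong ¬'_ (χ⁻¹-χ A))
χ⁻¹-χ (A ∧' B) = cong₂ _∧'_ (χ⁻¹-χ A) (χ⁻¹-χ B)
χ⁻¹-χ (A ∨' B) = cong₂ _∨'_ (χ⁻¹-χ A) (χ⁻¹-χ B)
χ⁻¹-χ (A ⇒ B)  = cong₂ _⇒_ (χ⁻¹-χ A) (χ⁻¹-χ B)
χ⁻¹-χ (□ A)    = cong □_ (χ⁻¹-χ A)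

propositionB2 : (A : Fm) → (NR⊢ A) ⇔ (NR⊢ χ A)
propositionB2 A = mk⇔ NR⊢-χ (λ ⊢χA → subst NR⊢_ (χ⁻¹-χ A) (NR⊢-χ⁻¹ ⊢χA))
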